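{- Let $\mathcal{A}=(\Gamma,S,s_0,F,\delta)$ be a 1-clock ATA with $S=\{s_0,s_1,\dots,s_k\}$, and let $\mathsf{Norm}(\mathcal{A})=(\Gamma,S',s_0^r,F',\delta')$ be defined by: $S'=\{s_i^r:0\le i\le k\}\cup\{s_i^{nr,j}:0\le i,j\le k\}$; $F'=\{s_i^r,s_i^{nr,j}: s_i\in F,\ 0\le j\le k\}$; and for each $i$ and $a\in\Gamma$, if $\delta(s_i,a)=\varphi$, then $\delta'(s_i^{nr,j},a)$ (for each $j$) is obtained from $\varphi$ by replacing every occurrence $x.s_h$ by $x.s_h^r$ and every other occurrence of a location $s_h$ by $s_h^{nr,j}$, and $\delta'(s_i^r,a)$ is obtained from $\varphi$ by replacing every $x.s_h$ by $x.s_h^r$ and every other occurrence of $s_h$ by $s_h^{nr,i}$. Then $L(\mathcal{A})=L(\mathsf{Norm}(\mathcal{A}))$.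
   Context: $\Sigma$ finite, $\Gamma=2^\Sigma\setminus\{\emptyset\}$; timed words $\rho=(\sigma_1,\tau_1)\cdots(\sigma_n,\tau_n)$ with $\sigma_i\in\Gamma$, $\tau_1=0$, $\tau_i\le\tau_{i+1}$. A 1-clock ATA $(\Gamma,S,s_0,F,\delta)$ has $\delta:S\times\Gamma\to\Phi(S)$ with $\Phi(S)$: $\varphi::=\top\mid\bot\mid\varphi\wedge\varphi\mid\varphi\vee\varphi\mid s\mid x\in I\mid x.s$ ($I$ an interval with endpoints in $\mathbb{N}\cup\{\infty\}$; $x.s$: go to $s$ resetting the clock $x$ to 0). Successor of configuration $C$ (finite set of $(s,\nu)$) on $a$: for each $(s,\nu)\in C$ choose $M\subseteq S\cup\{x.q\}$ satisfying $\delta(s,a)$ ($x\in I$ true iff $\nu\in I$), unite $\{(p,\nu):p\in M\}\cup\{(q,0):x.q\in M\}$. A run on $\rho$ starts at $\{(s_0,0)\}$, and for $i=1..n$ adds $\tau_i-\tau_{i-1}$ ($\tau_0=0$) to all valuations and takes a successor on $\sigma_i$; $\rho\in L$ iff some run ends with all locations final (empty configuration accepting). -}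

module Defs where

open import Data.Nat using (ℕ)
open import Data.Fin using (Fin)
open import Data.Fin.Subset using (Subset; Nonempty)
open import Data.Bool using (Bool; true; false; T)
open import Data.Maybe using (Maybe; just; nothing)
open import Data.Product using (Σ; _×_; _,_; ∃)
open import Data.Sum using (_⊎_; inj₁; inj₂)
open import Data.Unit using (⊤)
open import Data.Empty using (⊥)
open import Data.List using (List; []; _∷_; map; _++_)
open import Data.List.Membership.Propositional using (_∈_)
open import Data.List.Relation.Unary.All using (All)
open import Function.Bundles using (_⇔_)

-- The paper
-- uses the non-negative reals; the result is stated for every such domain
-- (ℝ≥0 being one instance).
record TimeDomain : Set₁ where
  field
    Time   : Set
    t0     : Time
    _+ₜ_   : Time → Time → Time
    _-ₜ_   : Time → Time → Time
    _≤ₜ_   : Time → Time → Set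
    _<ₜ_   : Time → Time → Set
    fromℕ  : ℕ → Time

Γ : ℕ → Set
Γ m = Σ (Subset m) Nonempty

-- Intervals with endpoints in ℕ ∪ {∞} (nothing = ∞); Bool = endpoint closed
record Interval : Set where
  constructor interval
  field
    lower       : Maybe ℕ
    lowerClosed : Bool
    upper       : Maybe ℕ
    upperClosed : Bool

data Φ (S : Set) : Set where
  tt ff   : Φ S
  _∧ᶠ_ _∨ᶠ_ : Φ S → Φ S → Φ S
  loc     : S → Φ S
  clk     : Interval → Φ S
  reset   : S → Φ S

-- Location type of choices M ⊆ S ∪ {x.q}: inj₁ s = s, inj₂ q = x.q
Loc : Set → Set
Loc S = S ⊎ S

record ATA (Γ' S : Set) : Set where
  field
    s₀ : S
    F  : S → Bool
    δ  : S → Γ' → Φ S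

module Semantics (TD : TimeDomain) where
  open TimeDomain TD

  _∈I_ : Time → Interval → Set
  ν ∈I interval lo lc up uc = lowOK lo lc × upOK up uc
    where
    lowOK : Maybe ℕ → Bool → Set
    lowOK nothing  _     = ⊥
    lowOK (just n) true  = fromℕ n ≤ₜ ν
    lowOK (just n) false = fromℕ n <ₜ ν
    upOK : Maybe ℕ → Bool → Set
    upOK nothing  _     = ⊤
    upOK (just n) true  = ν ≤ₜ fromℕ n
    upOK (just n) false = ν <ₜ fromℕ n

  Sat : {S : Set} → Time → List (Loc S) → Φ S → Set
  Sat ν M tt          = ⊤
  Sat ν M ff          = ⊥
  Sat ν M (φ ∧ᶠ ψ)    = Sat ν M φ × Sat ν M ψ
  Sat ν M (φ ∨ᶠ ψ)    = Sat ν M φ ⊎ Sat ν M ψ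
  Sat ν M (loc s)     = inj₁ s ∈ M
  Sat ν M (clk I)     = ν ∈I I
  Sat ν M (reset s)   = inj₂ s ∈ M

  -- configurations: finite sets of (location, clock value), as lists
  Config : Set → Set
  Config S = List (S × Time)

  image : {S : Set} → Time → List (Loc S) → Config S
  image ν = map f
    where
    f : _ → _
    f (inj₁ p) = (p , ν)
    f (inj₂ q) = (q , t0)

  data Step {G S : Set} (δ : S → G → Φ S) (a : G) : Config S → Config S → Set where
    []  : Step δ a [] []
    _∷_ : ∀ {s ν C C'} {M : List (Loc S)} →
          Sat ν M (δ s a) → Step δ a C C' →
          Step δ a ((s , ν) ∷ C) (image ν M ++ C')

  elapse : {S : Set} → Time → Config S → Config S
  elapse d = map (λ { (s , ν) → (s , ν +ₜ d) })

  -- Reach δ τprev C ρ C' : run on ρ from C (previous timestamp τprev) ends in C'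
  data Reach {G S : Set} (δ : S → G → Φ S) : Time → Config S → List (G × Time) → Config S → Set where
    done : ∀ {τ C} → Reach δ τ C [] C
    step : ∀ {τp C a τ C' ρ Cf} →
           Step δ a (elapse (τ -ₜ τp) C) C' → Reach δ τ C' ρ Cf →
           Reach δ τp C ((a , τ) ∷ ρ) Cf

  Accepts : {G S : Set} → ATA G S → List (G × Time) → Set
  Accepts A ρ = ∃ λ Cf → Reach (ATA.δ A) t0 ((ATA.s₀ A , t0) ∷ []) ρ Cf
                        × All (λ c → T (ATA.F A (Data.Product.proj₁ c))) Cf

  data Monotone {G : Set} : Time → List (G × Time) → Set where
    []  : ∀ {τ} → Monotone τ []
    _∷_ : ∀ {τ a τ' ρ} → τ ≤ₜ τ' → Monotone τ' ρ → Monotone τ ((a , τ') ∷ ρ)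

  IsTimedWord : {G : Set} → List (G × Time) → Set
  IsTimedWord []             = ⊤
  IsTimedWord ((a , τ) ∷ ρ)  = (τ ≡ᵗ t0) × Monotone τ ρ
    where open import Relation.Binary.PropositionalEquality renaming (_≡_ to _≡ᵗ_)

-- Norm construction.  States: inj₁ i = s_i^r, inj₂ (i , j) = s_i^{nr,j}
NState : ℕ → Set
NState k = Fin k ⊎ (Fin k × Fin k)

rename : {S S' : Set} → (S → S') → (S → S') → Φ S → Φ S'
rename nr r tt        = tt
rename nr r ff        = ff
rename nr r (φ ∧ᶠ ψ)  = rename nr r φ ∧ᶠ rename nr r ψ
rename nr r (φ ∨ᶠ ψ)  = rename nr r φ ∨ᶠ rename nr r ψ
rename nr r (loc s)   = loc (nr s)
rename nr r (clk I)   = clk I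
rename nr r (reset s) = reset (r s)

Norm : {G : Set} {k : ℕ} → ATA G (Fin k) → ATA G (NState k)
Norm {G} {k} A = record { s₀ = inj₁ (ATA.s₀ A) ; F = F' ; δ = δ' }
  where
  F' : NState k → Bool
  F' (inj₁ i)       = ATA.F A i
  F' (inj₂ (i , j)) = ATA.F A i
  nr : Fin k → Fin k → NState k
  nr j h = inj₂ (h , j)
  δ' : NState k → G → Φ (NState k)
  δ' (inj₁ i)       a = rename (nr i) inj₁ (ATA.δ A i a)
  δ' (inj₂ (i , j)) a = rename (nr j) inj₁ (ATA.δ A i a)

module Submission where

-- Every location of Norm(A) is a copy of a location of A: forgetting the
-- annotation (s_i^r ↦ s_i, s_i^{nr,j} ↦ s_i) is a map π with the property that
-- each transition formula of Norm(A) is a transition formula of A with its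
-- locations renamed by maps that π undoes.  We call such a pair of automata a
-- *renaming cover* and prove, for an arbitrary cover, that the two automata
-- accept the same timed words:
--   * a choice M satisfying a renamed formula projects (along π) to a choice
--     satisfying the original formula, and conversely a choice for the
--     original formula lifts (along the renaming maps) to one for the renamed
--     formula;
--   * projecting configurations commutes with successor images and with time
--     elapse, so runs of the cover project to runs of A, and runs of A lift
--     to runs of the cover starting from any configuration above theirs;
--   * finality is read off the projected location, so acceptance transfers.
-- Finally Norm(A) is a renaming cover of A with all conditions holding by
-- computation, which gives lemma3 (for any time domain and any word).

open import Defs
open import Data.Nat using (ℕ; suc)
open import Data.Fin using (Fin)
open import Data.List using (List; []; _∷_; map; _++_)
open import Data.List.Properties using (map-++; map-∘; map-cong; map-id)
open import Data.List.Membership.Propositional using (_∈_)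
open import Data.List.Membership.Propositional.Properties using (∈-map⁺)
open import Data.List.Relation.Unary.All as All using (All)
open import Data.List.Relation.Unary.All.Properties using (map⁻; map⁺)
open import Data.Product using (_×_; _,_; proj₁; ∃; map₁)
open import Data.Sum using (inj₁; inj₂)
import Data.Sum as Sum
open import Data.Bool using (T)
open import Function.Bundles using (_⇔_; mk⇔)
open import Relation.Binary.PropositionalEquality
  using (_≡_; refl; sym; trans; cong; cong₂; subst; module ≡-Reasoning)

record RenamingCover {G S S' : Set} (A' : ATA G S') (A : ATA G S) : Set where
  field
    π              : S' → S
    nonReset       : S' → S → S'
    onReset        : S → S'
    π-nonReset     : ∀ s' s → π (nonReset s' s) ≡ s
    π-onReset      : ∀ s → π (onReset s) ≡ s
    δ-renamed      : ∀ s' a →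
                     ATA.δ A' s' a ≡ rename (nonReset s') onReset (ATA.δ A (π s') a)
    F-projected    : ∀ s' → ATA.F A' s' ≡ ATA.F A (π s')
    s₀-projected   : π (ATA.s₀ A') ≡ ATA.s₀ A

module _ (TD : TimeDomain) where
  open TimeDomain TD
  open Semantics TD

  sat-project : ∀ {S S'} (f g : S → S') (h : S' → S) →
                (∀ s → h (f s) ≡ s) → (∀ s → h (g s) ≡ s) →
                ∀ ν M φ → Sat ν M (rename f g φ) → Sat ν (map (Sum.map h h) M) φ
  sat-project f g h hf hg ν M tt       p        = p
  sat-project f g h hf hg ν M (φ ∧ᶠ ψ) (p , q)  =
    sat-project f g h hf hg ν M φ p , sat-project f g h hf hg ν M ψ q
  sat-project f g h hf hg ν M (φ ∨ᶠ ψ) (inj₁ p) = inj₁ (sat-project f g h hf hg ν M φ p)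
  sat-project f g h hf hg ν M (φ ∨ᶠ ψ) (inj₂ p) = inj₂ (sat-project f g h hf hg ν M ψ p)
  sat-project f g h hf hg ν M (loc s)   p =
    subst (λ x → inj₁ x ∈ _) (hf s) (∈-map⁺ (Sum.map h h) p)
  sat-project f g h hf hg ν M (clk I)   p = p
  sat-project f g h hf hg ν M (reset s) p =
    subst (λ x → inj₂ x ∈ _) (hg s) (∈-map⁺ (Sum.map h h) p)

  sat-lift : ∀ {S S'} (f g : S → S') →
             ∀ ν M φ → Sat ν M φ → Sat ν (map (Sum.map f g) M) (rename f g φ)
  sat-lift f g ν M tt       p        = p
  sat-lift f g ν M (φ ∧ᶠ ψ) (p , q)  = sat-lift f g ν M φ p , sat-lift f g ν M ψ q
  sat-lift f g ν M (φ ∨ᶠ ψ) (inj₁ p) = inj₁ (sat-lift f g ν M φ p)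
  sat-lift f g ν M (φ ∨ᶠ ψ) (inj₂ p) = inj₂ (sat-lift f g ν M ψ p)
  sat-lift f g ν M (loc s)   p = ∈-map⁺ (Sum.map f g) p
  sat-lift f g ν M (clk I)   p = p
  sat-lift f g ν M (reset s) p = ∈-map⁺ (Sum.map f g) p

  project : ∀ {S S'} → (S' → S) → Config S' → Config S
  project h = map (map₁ h)

  -- Projection commutes with forming the successor image of a choice
  -- (resets go to clock value 0 on both sides) ...
  project-image : ∀ {S S'} (h : S' → S) ν M →
                  project h (image ν M) ≡ image ν (map (Sum.map h h) M)
  project-image h ν []           = refl
  project-image h ν (inj₁ _ ∷ M) = cong (_ ∷_) (project-image h ν M)
  project-image h ν (inj₂ _ ∷ M) = cong (_ ∷_) (project-image h ν M)

  project-image-lift : ∀ {S S'} (f g : S → S') (h : S' → S) →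
                       (∀ s → h (f s) ≡ s) → (∀ s → h (g s) ≡ s) → ∀ ν M →
                       project h (image ν (map (Sum.map f g) M)) ≡ image ν M
  project-image-lift f g h hf hg ν M = begin
    project h (image ν (map (Sum.map f g) M))         ≡⟨ project-image h ν _ ⟩
    image ν (map (Sum.map h h) (map (Sum.map f g) M)) ≡⟨ cong (image ν) round-trip ⟩
    image ν M                                         ∎
    where
    open ≡-Reasoning
    undo : ∀ l → Sum.map h h (Sum.map f g l) ≡ l
    undo (inj₁ s) = cong inj₁ (hf s)
    undo (inj₂ s) = cong inj₂ (hg s)
    round-trip : map (Sum.map h h) (map (Sum.map f g) M) ≡ M
    round-trip = trans (sym (map-∘ M)) (trans (map-cong undo M) (map-id M))

  project-elapse : ∀ {S S'} (h : S' → S) d C →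
                   project h (elapse d C) ≡ elapse d (project h C)
  project-elapse h d []      = refl
  project-elapse h d (_ ∷ C) = cong (_ ∷_) (project-elapse h d C)

  module CoverRuns {G S S'} {A' : ATA G S'} {A : ATA G S}
                   (cover : RenamingCover A' A) where
    open RenamingCover cover

    δ' : S' → G → Φ S'
    δ' = ATA.δ A'

    δ : S → G → Φ S
    δ = ATA.δ A

    step-project : ∀ {a D D'} → Step δ' a D D' → Step δ a (project π D) (project π D')
    step-project [] = []
    step-project {a} (_∷_ {s'} {ν} {C} {C'} {M} sat st) =
      subst (Step δ a (project π ((s' , ν) ∷ C))) projected-target
        (sat-project (nonReset s') onReset π (π-nonReset s') π-onReset ν M (δ (π s') a)
           (subst (Sat ν M) (δ-renamed s' a) sat)
         ∷ step-project st)
      where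
      projected-target : image ν (map (Sum.map π π) M) ++ project π C'
                         ≡ project π (image ν M ++ C')
      projected-target = trans (cong (_++ project π C') (sym (project-image π ν M)))
                               (sym (map-++ _ (image ν M) C'))

    run-project : ∀ {τ D ρ Df} → Reach δ' τ D ρ Df → Reach δ τ (project π D) ρ (project π Df)
    run-project done = done
    run-project {D = D} (step {τp} {τ = τ} st r) =
      step (subst (λ X → Step δ _ X _) (project-elapse π (τ -ₜ τp) D) (step-project st))
           (run-project r)

    step-lift : ∀ {a C C₂} D → project π D ≡ C → Step δ a C C₂ →
                ∃ λ D₂ → Step δ' a D D₂ × project π D₂ ≡ C₂
    step-lift [] refl [] = [] , [] , refl
    step-lift {a} ((s' , ν) ∷ D) refl (_∷_ {M = M} sat st) with step-lift D refl st
    ... | D₂ , st₂ , D₂-projects =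
      (image ν M' ++ D₂) ,
      (subst (Sat ν M') (sym (δ-renamed s' a))
         (sat-lift (nonReset s') onReset ν M (δ (π s') a) sat) ∷ st₂) ,
      trans (map-++ _ (image ν M') D₂)
            (cong₂ _++_ (project-image-lift (nonReset s') onReset π
                           (π-nonReset s') π-onReset ν M)
                        D₂-projects)
      where
      M' = map (Sum.map (nonReset s') onReset) M

    run-lift : ∀ {τ C ρ Cf} D → project π D ≡ C → Reach δ τ C ρ Cf →
               ∃ λ Df → Reach δ' τ D ρ Df × project π Df ≡ Cf
    run-lift D D-projects done = D , done , D-projects
    run-lift D D-projects (step {τp} {τ = τ} st r)
      with step-lift (elapse (τ -ₜ τp) D)
                     (trans (project-elapse π (τ -ₜ τp) D)
                            (cong (elapse (τ -ₜ τp)) D-projects))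
                     st
    ... | D₂ , st₂ , D₂-projects with run-lift D₂ D₂-projects r
    ... | Df , r' , Df-projects = Df , step st₂ r' , Df-projects

    Final' : S' × Time → Set
    Final' c = T (ATA.F A' (proj₁ c))

    Final : S × Time → Set
    Final c = T (ATA.F A (proj₁ c))

    final-project : ∀ D → All Final' D → All Final (project π D)
    final-project D acc =
      map⁺ (All.map (λ {c} → subst T (F-projected (proj₁ c))) acc)

    final-lift : ∀ D → All Final (project π D) → All Final' D
    final-lift D acc =
      All.map (λ {c} → subst T (sym (F-projected (proj₁ c)))) (map⁻ acc)

    initial-projects : project π ((ATA.s₀ A' , t0) ∷ []) ≡ (ATA.s₀ A , t0) ∷ []
    initial-projects = cong (λ s → (s , t0) ∷ []) s₀-projected

    same-language : ∀ ρ → Accepts A ρ ⇔ Accepts A' ρ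
    same-language ρ = mk⇔ lift-acceptance project-acceptance
      where
      lift-acceptance : Accepts A ρ → Accepts A' ρ
      lift-acceptance (Cf , r , acc) with run-lift _ initial-projects r
      ... | Df , r' , refl = Df , r' , final-lift Df acc

      project-acceptance : Accepts A' ρ → Accepts A ρ
      project-acceptance (Df , r , acc) =
        project π Df , subst (λ C → Reach δ t0 C ρ (project π Df)) initial-projects (run-project r) ,
        final-project Df acc

Norm-cover : ∀ {G k} (A : ATA G (Fin k)) → RenamingCover (Norm A) A
Norm-cover {G} {k} A = record
  { π            = forget
  ; nonReset     = λ s' h → inj₂ (h , label s')
  ; onReset      = inj₁
  ; π-nonReset   = λ _ _ → refl
  ; π-onReset    = λ _ → refl
  ; δ-renamed    = δ-renamed
  ; F-projected  = F-projected
  ; s₀-projected = refl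
  }
  where
  forget : NState k → Fin k
  forget (inj₁ i)       = i
  forget (inj₂ (i , _)) = i

  label : NState k → Fin k
  label (inj₁ i)       = i
  label (inj₂ (_ , j)) = j

  δ-renamed : ∀ s' a → ATA.δ (Norm A) s' a
                     ≡ rename (λ h → inj₂ (h , label s')) inj₁ (ATA.δ A (forget s') a)
  δ-renamed (inj₁ _) _ = refl
  δ-renamed (inj₂ _) _ = refl

  F-projected : ∀ s' → ATA.F (Norm A) s' ≡ ATA.F A (forget s')
  F-projected (inj₁ _) = refl
  F-projected (inj₂ _) = refl

-- L(A) = L(Norm(A)).
lemma3 : (TD : TimeDomain) {m k : ℕ} (A : ATA (Γ m) (Fin (suc k)))
         (ρ : List (Γ m × TimeDomain.Time TD)) →
         Semantics.IsTimedWord TD ρ →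
         Semantics.Accepts TD A ρ ⇔ Semantics.Accepts TD (Norm A) ρ
lemma3 TD A ρ _ = CoverRuns.same-language TD (Norm-cover A) ρ
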